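{- Let $G=(V,E)$ be a fixed (static) connected undirected graph on $n\ge 2$ vertices with vertex expansion $\alpha$. Then in the mobile telephone model on $G$ (topology never changes), the optimal rumor spreading algorithm terminates in $O((1/\alpha)\log n)$ rounds; that is, there is an absolute constant $C$ such that there exists a schedule of connections, valid in this model, that informs all nodes within $C\,(1/\alpha)\log n$ rounds, starting from any single source.
   Context: Vertex expansion: for $S\subseteq V$ let $\partial S=\{v\in V\setminus S: N(v)\cap S\neq\emptyset\}$ and $\alpha(S)=|\partial S|/|S|$; then $\alpha=\min_{S\subset V,\,0<|S|\le n/2}\alpha(S)$. Mobile telephone model: time proceeds in synchronous rounds; at the start of each round each node knows its neighbor set; each node may send a connection proposal to at most one neighbor; a node that sends a proposal cannot receive one; a node that sent no proposal and received at least one proposal may accept at most one of them; two nodes whose proposal was accepted are connected and can exchange an unbounded amount of information in that round. Hence the connections in a round form a matching of $G$. Rumor spreading problem: a single distinguished source starts with a rumor; the problem is solved once all nodes know the rumor (a node learns the rumor only via a connection with a node knowing it). -}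

module Defs where

open import Data.Nat using (ℕ; zero; suc; _+_; _*_; _≤_; _<_)
open import Data.Fin using (Fin)
open import Data.Fin.Subset using (Subset; ∣_∣)
open import Data.Bool using (Bool; true; false; _∧_; _∨_; not)
open import Data.Maybe using (Maybe; just; nothing)
open import Data.Vec using (tabulate; lookup)
open import Data.Product using (Σ; _×_; ∃)
open import Data.Sum using (_⊎_)
open import Relation.Binary.PropositionalEquality using (_≡_)

record Graph (n : ℕ) : Set where
  field
    adj    : Fin n → Fin n → Bool
    sym    : ∀ u v → adj u v ≡ adj v u
    irrefl : ∀ v → adj v v ≡ false
open Graph public

Adj : ∀ {n} → Graph n → Fin n → Fin n → Set
Adj G u v = adj G u v ≡ true

data Reach {n : ℕ} (G : Graph n) (u : Fin n) : Fin n → Set where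
  here : Reach G u u
  step : ∀ {v w} → Reach G u v → Adj G v w → Reach G u w

Connected : ∀ {n} → Graph n → Set
Connected {n} G = ∀ (u v : Fin n) → Reach G u v

anyFin : ∀ {n} → (Fin n → Bool) → Bool
anyFin {zero}  f = false
anyFin {suc n} f = f Fin.zero ∨ anyFin (λ i → f (Fin.suc i))

boundary : ∀ {n} → Graph n → Subset n → Subset n
boundary G S = tabulate λ v → not (lookup S v) ∧ anyFin (λ u → lookup S u ∧ adj G u v)

-- "The vertex expansion α of G equals p/q" (q > 0):
-- α = min over S with 0 < |S| ≤ n/2 of |∂S|/|S|.
IsVertexExpansion : ∀ {n} → Graph n → ℕ → ℕ → Set
IsVertexExpansion {n} G p q =
  (0 < q)
  × (∃ λ (S : Subset n) → 0 < ∣ S ∣ × 2 * ∣ S ∣ ≤ n × ∣ boundary G S ∣ * q ≡ p * ∣ S ∣)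
  × (∀ (S : Subset n) → 0 < ∣ S ∣ → 2 * ∣ S ∣ ≤ n → p * ∣ S ∣ ≤ ∣ boundary G S ∣ * q)

record Round (n : ℕ) : Set where
  field
    propose : Fin n → Maybe (Fin n)
    accept  : Fin n → Maybe (Fin n)
open Round public

ValidRound : ∀ {n} → Graph n → Round n → Set
ValidRound {n} G r =
  (∀ (v w : Fin n) → propose r v ≡ just w → Adj G v w)
  × (∀ (w v : Fin n) → accept r w ≡ just v → (propose r v ≡ just w) × (propose r w ≡ nothing))

Linked : ∀ {n} → Round n → Fin n → Fin n → Set
Linked r u v =
  (propose r u ≡ just v × accept r v ≡ just u) ⊎ (propose r v ≡ just u × accept r u ≡ just v)

Schedule : ℕ → Set
Schedule n = ℕ → Round n

ValidSchedule : ∀ {n} → Graph n → Schedule n → Set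
ValidSchedule G σ = ∀ t → ValidRound G (σ t)

-- Informed σ s t v : node v knows the rumor after the first t rounds (rounds 0..t-1),
-- starting from source s.
data Informed {n : ℕ} (σ : Schedule n) (s : Fin n) : ℕ → Fin n → Set where
  source : Informed σ s 0 s
  keep   : ∀ {t v} → Informed σ s t v → Informed σ s (suc t) v
  recv   : ∀ {t u v} → Informed σ s t u → Linked (σ t) u v → Informed σ s (suc t) v

-- In every round, the informed set X is joined to its complement by a greedy maximal matching and
-- every matched pair passes the rumour on. By maximality, the informed nodes left unmatched have
-- their whole vertex boundary among the matched nodes, so a round with m matched pairs has
-- α|X| ≤ 4m while |X| ≤ n/2, and symmetrically α|V∖X| ≤ 4m while |V∖X| ≤ n/2 (using α ≤ 2).
-- Hence every block of R ≈ 8/α rounds triples the informed set until it covers half of the graph,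
-- and afterwards divides the uninformed set by three; ⌈log₂ n⌉ blocks of each kind inform every
-- node within 2R⌈log₂ n⌉ ≤ 20⌈log₂ n⌉/α rounds.

module Submission where

open import Defs hiding (sym)
open import Data.Bool using (Bool; true; false; _∧_; _∨_; not; if_then_else_)
import Data.Bool.Properties as Bool
open import Data.Bool.Properties using (∧-conicalˡ; ∧-conicalʳ)
open import Data.Fin using (Fin; zero; suc; toℕ; _≟_)
import Data.Fin.Properties as Fin
open import Data.Fin.Subset using (Subset; ∣_∣)
open import Data.List using (List; []; _∷_; allFin)
open import Data.List.Membership.Propositional using (_∈_)
open import Data.List.Membership.Propositional.Properties using (∈-allFin)
open import Data.List.Relation.Unary.Any using (here; there)
open import Data.Maybe using (Maybe; just; nothing; is-just)
open import Data.Nat hiding (_≟_)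
open import Data.Nat.DivMod using (_/_; _%_; m≡m%n+[m/n]*n; m%n<n; m/n*n≤m)
open import Data.Nat.Induction using (<-rec)
open import Data.Nat.Logarithm using (⌈log₂_⌉; ⌈log₂⌉-mono-≤; ⌈log₂2^n⌉≡n; ⌈log₂⌈n/2⌉⌉≡⌈log₂n⌉∸1)
open import Data.Nat.Properties hiding (_≟_)
open import Data.Nat.Tactic.RingSolver using (solve-∀)
open import Data.Product using (Σ; _×_; ∃; _,_; proj₁; proj₂)
open import Data.Sum using (_⊎_; inj₁; inj₂)
open import Data.Vec using ([]; _∷_; lookup; tabulate)
open import Data.Vec.Functional using (updateAt)
open import Data.Vec.Functional.Properties using (updateAt-updates; updateAt-minimal)
open import Data.Vec.Properties using (lookup∘tabulate)
open import Function using (_∘_; const; case_of_)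
open import Relation.Binary.PropositionalEquality
open import Relation.Nullary using (Dec; yes; no; does; contradiction)
open import Relation.Nullary.Decidable using (_×-dec_; dec-true)

⌈n/2⌉≤1+⌊n/2⌋ : ∀ n → ⌈ n /2⌉ ≤ suc ⌊ n /2⌋
⌈n/2⌉≤1+⌊n/2⌋ zero          = z≤n
⌈n/2⌉≤1+⌊n/2⌋ (suc zero)    = ≤-refl
⌈n/2⌉≤1+⌊n/2⌋ (suc (suc n)) = s≤s (⌈n/2⌉≤1+⌊n/2⌋ n)

2*⌊n/2⌋≤n : ∀ n → 2 * ⌊ n /2⌋ ≤ n
2*⌊n/2⌋≤n n = begin
  2 * ⌊ n /2⌋           ≡⟨ cong (⌊ n /2⌋ +_) (+-identityʳ ⌊ n /2⌋) ⟩
  ⌊ n /2⌋ + ⌊ n /2⌋     ≤⟨ +-monoʳ-≤ ⌊ n /2⌋ (⌊n/2⌋≤⌈n/2⌉ n) ⟩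
  ⌊ n /2⌋ + ⌈ n /2⌉     ≡⟨ ⌊n/2⌋+⌈n/2⌉≡n n ⟩
  n                     ∎
  where open ≤-Reasoning

0<⌊n/2⌋ : ∀ {n} → 2 ≤ n → 0 < ⌊ n /2⌋
0<⌊n/2⌋ {suc (suc n)} _ = s≤s z≤n
0<⌊n/2⌋ {suc zero} (s≤s ())

1≤⌈log₂n⌉ : ∀ {n} → 2 ≤ n → 1 ≤ ⌈log₂ n ⌉
1≤⌈log₂n⌉ {n} 2≤n = subst (_≤ ⌈log₂ n ⌉) (⌈log₂2^n⌉≡n 1) (⌈log₂⌉-mono-≤ 2≤n)

n≤2*⌈n/2⌉ : ∀ n → n ≤ 2 * ⌈ n /2⌉
n≤2*⌈n/2⌉ n = begin
  n                           ≡⟨ ⌊n/2⌋+⌈n/2⌉≡n n ⟨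
  ⌊ n /2⌋ + ⌈ n /2⌉           ≤⟨ +-monoˡ-≤ ⌈ n /2⌉ (⌊n/2⌋≤⌈n/2⌉ n) ⟩
  ⌈ n /2⌉ + ⌈ n /2⌉           ≡⟨ cong (⌈ n /2⌉ +_) (+-identityʳ ⌈ n /2⌉) ⟨
  2 * ⌈ n /2⌉                 ∎
  where open ≤-Reasoning

n≤2^⌈log₂n⌉ : ∀ n → n ≤ 2 ^ ⌈log₂ n ⌉
n≤2^⌈log₂n⌉ = <-rec _ bound
  where
  bound : ∀ n → (∀ {m} → m < n → m ≤ 2 ^ ⌈log₂ m ⌉) → n ≤ 2 ^ ⌈log₂ n ⌉
  bound 0 _ = z≤n
  bound 1 _ = ≤-refl
  bound n@(suc (suc k)) rec = begin
    n                                ≤⟨ n≤2*⌈n/2⌉ n ⟩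
    2 * ⌈ n /2⌉                      ≤⟨ *-monoʳ-≤ 2 (rec (⌈n/2⌉<n k)) ⟩
    2 * 2 ^ ⌈log₂ ⌈ n /2⌉ ⌉          ≡⟨ cong (λ e → 2 ^ suc e) (⌈log₂⌈n/2⌉⌉≡⌈log₂n⌉∸1 n) ⟩
    2 ^ suc (⌈log₂ n ⌉ ∸ 1)          ≡⟨ cong (2 ^_) (m+[n∸m]≡n (1≤⌈log₂n⌉ {n} (s≤s (s≤s z≤n)))) ⟩
    2 ^ ⌈log₂ n ⌉                    ∎
    where open ≤-Reasoning

complement-≤half : ∀ {a b n} → a + b ≡ n → n ≤ 2 * a → 2 * b ≤ n
complement-≤half {a} {b} {n} a+b≡n n≤2a = +-cancelˡ-≤ n _ _ (begin
  n + 2 * b          ≤⟨ +-monoˡ-≤ (2 * b) n≤2a ⟩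
  2 * a + 2 * b      ≡⟨ *-distribˡ-+ 2 a b ⟨
  2 * (a + b)        ≡⟨ cong (2 *_) a+b≡n ⟩
  2 * n              ≡⟨ cong (n +_) (+-identityʳ n) ⟩
  n + n              ∎)
  where open ≤-Reasoning

accumulate : ∀ (f : ℕ → ℕ) L k t → (∀ i → i < k → f (i + t) + L ≤ f (suc (i + t))) →
             f t + k * L ≤ f (k + t)
accumulate f L zero    t _     = ≤-reflexive (+-identityʳ (f t))
accumulate f L (suc k) t grows = begin
  f t + (L + k * L)     ≡⟨ cong (f t +_) (+-comm L (k * L)) ⟩
  f t + (k * L + L)     ≡⟨ +-assoc (f t) (k * L) L ⟨
  (f t + k * L) + L     ≤⟨ +-monoˡ-≤ L (accumulate f L k t λ i i<k → grows i (m≤n⇒m≤1+n i<k)) ⟩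
  f (k + t) + L         ≤⟨ grows k ≤-refl ⟩
  f (suc (k + t))       ∎
  where open ≤-Reasoning

-- Counting Boolean predicates on Fin n

count : ∀ {n} → (Fin n → Bool) → ℕ
count {zero}  f = 0
count {suc n} f = (if f zero then 1 else 0) + count (λ i → f (suc i))

count-cong : ∀ {n} {f g : Fin n → Bool} → (∀ x → f x ≡ g x) → count f ≡ count g
count-cong {zero}  f≗g = refl
count-cong {suc n} f≗g = cong₂ _+_ (cong (if_then 1 else 0) (f≗g zero)) (count-cong (f≗g ∘ suc))

count+count-not≡n : ∀ {n} (f : Fin n → Bool) → count f + count (not ∘ f) ≡ n
count+count-not≡n {zero}  f = refl
count+count-not≡n {suc n} f with f zero
... | true  = cong suc (count+count-not≡n (f ∘ suc))
... | false = trans (+-suc _ _) (cong suc (count+count-not≡n (f ∘ suc)))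

count-∨+count-∧ : ∀ {n} (f g : Fin n → Bool) →
  count (λ x → f x ∨ g x) + count (λ x → f x ∧ g x) ≡ count f + count g
count-∨+count-∧ {zero}  f g = refl
count-∨+count-∧ {suc n} f g with f zero | g zero
... | true  | true  = cong suc (trans (+-suc _ _) (trans (cong suc rest) (sym (+-suc _ _))))
  where rest = count-∨+count-∧ (f ∘ suc) (g ∘ suc)
... | true  | false = cong suc (count-∨+count-∧ (f ∘ suc) (g ∘ suc))
... | false | true  = trans (cong suc (count-∨+count-∧ (f ∘ suc) (g ∘ suc))) (sym (+-suc _ _))
... | false | false = count-∨+count-∧ (f ∘ suc) (g ∘ suc)

count-mono : ∀ {n} {f g : Fin n → Bool} → (∀ x → f x ≡ true → g x ≡ true) → count f ≤ count g
count-mono {zero}          f⊆g = z≤n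
count-mono {suc n} {f} {g} f⊆g with f zero in f₀ | g zero in g₀
... | true  | true  = s≤s (count-mono (f⊆g ∘ suc))
... | false | true  = m≤n⇒m≤1+n (count-mono (f⊆g ∘ suc))
... | false | false = count-mono (f⊆g ∘ suc)
... | true  | false = case trans (sym (f⊆g zero f₀)) g₀ of λ ()

count-pos : ∀ {n} (f : Fin n → Bool) {x} → f x ≡ true → 1 ≤ count f
count-pos f {zero} fx rewrite fx = s≤s z≤n
count-pos f {suc x} fx = ≤-trans (count-pos (f ∘ suc) fx) (m≤n+m _ _)

count≡0⇒false : ∀ {n} (f : Fin n → Bool) → count f ≡ 0 → ∀ x → f x ≡ false
count≡0⇒false f count≡0 x with f x in fx
... | false = refl
... | true  = case subst (1 ≤_) count≡0 (count-pos f fx) of λ ()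

all-false⇒count≡0 : ∀ {n} (f : Fin n → Bool) → (∀ x → f x ≡ false) → count f ≡ 0
all-false⇒count≡0 {zero}  f f≡false = refl
all-false⇒count≡0 {suc n} f f≡false rewrite f≡false zero = all-false⇒count≡0 (f ∘ suc) (f≡false ∘ suc)

count-∨≤ : ∀ {n} (f g : Fin n → Bool) → count (λ x → f x ∨ g x) ≤ count f + count g
count-∨≤ f g = subst (count (λ x → f x ∨ g x) ≤_) (count-∨+count-∧ f g) (m≤m+n _ _)

count-∖+count : ∀ {n} (f g : Fin n → Bool) → (∀ x → g x ≡ true → f x ≡ true) →
  count (λ x → f x ∧ not (g x)) + count g ≡ count f
count-∖+count f g g⊆f = begin
  count f∖g + count g                                  ≡⟨ count-∨+count-∧ f∖g g ⟨
  count (λ x → f∖g x ∨ g x) + count (λ x → f∖g x ∧ g x) ≡⟨ cong₂ _+_ (count-cong ∖∨) (all-false⇒count≡0 _ ∖∧) ⟩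
  count f + 0                                          ≡⟨ +-identityʳ (count f) ⟩
  count f                                              ∎
  where
  open ≡-Reasoning
  f∖g : Fin _ → Bool
  f∖g x = f x ∧ not (g x)
  ∖∨ : ∀ x → (f x ∧ not (g x)) ∨ g x ≡ f x
  ∖∨ x with f x in fx | g x in gx
  ... | true  | true  = refl
  ... | true  | false = refl
  ... | false | false = refl
  ... | false | true  = trans (sym (g⊆f x gx)) fx
  ∖∧ : ∀ x → (f x ∧ not (g x)) ∧ g x ≡ false
  ∖∧ x with f x | g x
  ... | true  | true  = refl
  ... | true  | false = refl
  ... | false | _     = refl

count-pos⇒∃ : ∀ {n} (f : Fin n → Bool) → 1 ≤ count f → ∃ λ x → f x ≡ true
count-pos⇒∃ {suc n} f 1≤count with f zero in f₀
... | true  = zero , f₀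
... | false = let (x , fx) = count-pos⇒∃ (f ∘ suc) 1≤count in suc x , fx

count-insert : ∀ {n} {f g : Fin n → Bool} u → f u ≡ false → g u ≡ true →
  (∀ x → x ≢ u → g x ≡ f x) → count g ≡ suc (count f)
count-insert {suc n} zero fu gu g≗f rewrite fu | gu =
  cong suc (count-cong λ i → g≗f (suc i) λ ())
count-insert {suc n} {f} (suc u) fu gu g≗f rewrite g≗f zero (λ ()) =
  trans (cong ((if f zero then 1 else 0) +_)
               (count-insert u fu gu λ x x≢u → g≗f (suc x) (x≢u ∘ Fin.suc-injective)))
        (+-suc _ _)

count-<ᵇ : ∀ {m} k → k ≤ m → count (λ (i : Fin m) → toℕ i <ᵇ k) ≡ k
count-<ᵇ {m}     zero    _         = all-false⇒count≡0 (λ (i : Fin m) → toℕ i <ᵇ zero) λ _ → refl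
count-<ᵇ {suc m} (suc k) (s≤s k≤m) = cong suc (count-<ᵇ k k≤m)

∣S∣≡count : ∀ {n} (S : Subset n) → ∣ S ∣ ≡ count (lookup S)
∣S∣≡count []          = refl
∣S∣≡count (true ∷ S)  = cong suc (∣S∣≡count S)
∣S∣≡count (false ∷ S) = ∣S∣≡count S

∣tabulate∣≡count : ∀ {n} (f : Fin n → Bool) → ∣ tabulate f ∣ ≡ count f
∣tabulate∣≡count f = trans (∣S∣≡count (tabulate f)) (count-cong (lookup∘tabulate f))

anyFin⇒∃ : ∀ {n} (f : Fin n → Bool) → anyFin f ≡ true → ∃ λ x → f x ≡ true
anyFin⇒∃ {suc n} f any-f with f zero in f₀
... | true  = zero , f₀
... | false = let (x , fx) = anyFin⇒∃ (f ∘ suc) any-f in suc x , fx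

∃⇒anyFin : ∀ {n} (f : Fin n → Bool) {x} → f x ≡ true → anyFin f ≡ true
∃⇒anyFin f {zero}  fx rewrite fx = refl
∃⇒anyFin f {suc x} fx with f zero
... | true  = refl
... | false = ∃⇒anyFin (f ∘ suc) fx

anyFin-cong : ∀ {n} {f g : Fin n → Bool} → (∀ x → f x ≡ g x) → anyFin f ≡ anyFin g
anyFin-cong {zero}  f≗g = refl
anyFin-cong {suc n} f≗g = cong₂ _∨_ (f≗g zero) (anyFin-cong (f≗g ∘ suc))

-- Greedy maximal matchings

updateAt-const-cases : ∀ {A : Set} {n} (f : Fin n → A) u a {x b} → updateAt f u (const a) x ≡ b →
  (x ≡ u × a ≡ b) ⊎ (x ≢ u × f x ≡ b)
updateAt-const-cases f u a {x} fx≡b with x ≟ u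
... | yes refl = inj₁ (refl , trans (sym (updateAt-updates u f)) fx≡b)
... | no x≢u   = inj₂ (x≢u , trans (sym (updateAt-minimal x u f x≢u)) fx≡b)

just≢nothing-at : ∀ {A B : Set} {f : A → Maybe B} {x u b} → f x ≡ just b → f u ≡ nothing → x ≢ u
just≢nothing-at fx fu refl = case trans (sym fx) fu of λ ()

count-is-just-insert : ∀ {A : Set} {n} (f : Fin n → Maybe A) {u} a → f u ≡ nothing →
  count (is-just ∘ updateAt f u (const (just a))) ≡ suc (count (is-just ∘ f))
count-is-just-insert f {u} a fu =
  count-insert u (cong is-just fu) (cong is-just (updateAt-updates u f))
    λ x x≢u → cong is-just (updateAt-minimal x u f x≢u)

module GreedyMatching {n : ℕ} (G : Graph n) (X : Fin n → Bool) where

  record CrossEdge (u v : Fin n) : Set where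
    field
      informed-end   : X u ≡ true
      uninformed-end : X v ≡ false
      adjacent       : Adj G u v
  open CrossEdge public

  record Matching : Set where
    field
      round            : Round n
      accept⇒propose   : ∀ {u v} → accept round v ≡ just u → propose round u ≡ just v
      proposal-crosses : ∀ {u v} → propose round u ≡ just v → CrossEdge u v
      #proposers≡#acceptors : count (is-just ∘ propose round) ≡ count (is-just ∘ accept round)

  open Matching

  record _⊑_ (M M' : Matching) : Set where
    field
      keeps-propose : ∀ {u v} → propose (round M) u ≡ just v → propose (round M') u ≡ just v
      keeps-accept  : ∀ {u v} → accept (round M) v ≡ just u → accept (round M') v ≡ just u
  open _⊑_

  ⊑-refl : ∀ {M} → M ⊑ M
  ⊑-refl = record { keeps-propose = λ p → p ; keeps-accept = λ a → a }

  ⊑-trans : ∀ {M₁ M₂ M₃} → M₁ ⊑ M₂ → M₂ ⊑ M₃ → M₁ ⊑ M₃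
  ⊑-trans M₁⊑M₂ M₂⊑M₃ = record
    { keeps-propose = keeps-propose M₂⊑M₃ ∘ keeps-propose M₁⊑M₂
    ; keeps-accept  = keeps-accept M₂⊑M₃ ∘ keeps-accept M₁⊑M₂ }

  Saturated : Matching → Fin n → Set
  Saturated M u = X u ≡ true →
    (∃ λ v → propose (round M) u ≡ just v)
    ⊎ (∀ v → X v ≡ false → Adj G u v → ∃ λ w → accept (round M) v ≡ just w)

  Saturated-mono : ∀ {M M'} u → M ⊑ M' → Saturated M u → Saturated M' u
  Saturated-mono u M⊑M' sat Xu with sat Xu
  ... | inj₁ (v , pu) = inj₁ (v , keeps-propose M⊑M' pu)
  ... | inj₂ nbrs     = inj₂ λ v Xv uv → let (w , av) = nbrs v Xv uv in w , keeps-accept M⊑M' av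

  ∅ : Matching
  ∅ = record
    { round = record { propose = const nothing ; accept = const nothing }
    ; accept⇒propose = λ () ; proposal-crosses = λ () ; #proposers≡#acceptors = refl }

  add-edge : ∀ M {u v} → propose (round M) u ≡ nothing → accept (round M) v ≡ nothing →
             X u ≡ true → X v ≡ false → Adj G u v →
             Σ Matching λ M' → M ⊑ M' × propose (round M') u ≡ just v
  add-edge M {u} {v} pu av Xu Xv uv =
    M' , record { keeps-propose = extends-propose ; keeps-accept = extends-accept }
       , updateAt-updates u (propose (round M))
    where
    propose' accept' : Fin n → Maybe (Fin n)
    propose' = updateAt (propose (round M)) u (const (just v))
    accept'  = updateAt (accept (round M)) v (const (just u))

    extends-propose : ∀ {x y} → propose (round M) x ≡ just y → propose' x ≡ just y
    extends-propose px = trans (updateAt-minimal _ u (propose (round M)) (just≢nothing-at px pu)) px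

    extends-accept : ∀ {x y} → accept (round M) y ≡ just x → accept' y ≡ just x
    extends-accept ay = trans (updateAt-minimal _ v (accept (round M)) (just≢nothing-at ay av)) ay

    proposal-crosses' : ∀ {x y} → propose' x ≡ just y → CrossEdge x y
    proposal-crosses' p'x with updateAt-const-cases (propose (round M)) u (just v) p'x
    ... | inj₁ (refl , refl) = record { informed-end = Xu ; uninformed-end = Xv ; adjacent = uv }
    ... | inj₂ (_ , px)      = proposal-crosses M px

    accept⇒propose' : ∀ {x y} → accept' y ≡ just x → propose' x ≡ just y
    accept⇒propose' a'y with updateAt-const-cases (accept (round M)) v (just u) a'y
    ... | inj₁ (refl , refl) = updateAt-updates u (propose (round M))
    ... | inj₂ (_ , ay)      = extends-propose (accept⇒propose M ay)

    M' : Matching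
    M' = record
      { round = record { propose = propose' ; accept = accept' }
      ; accept⇒propose = accept⇒propose' ; proposal-crosses = proposal-crosses'
      ; #proposers≡#acceptors = begin
          count (is-just ∘ propose')      ≡⟨ count-is-just-insert (propose (round M)) v pu ⟩
          suc (count (is-just ∘ propose (round M))) ≡⟨ cong suc (#proposers≡#acceptors M) ⟩
          suc (count (is-just ∘ accept (round M)))  ≡⟨ count-is-just-insert (accept (round M)) u av ⟨
          count (is-just ∘ accept')       ∎ }
      where open ≡-Reasoning

  matching-valid : ∀ M → ValidRound G (round M)
  matching-valid M = (λ u v pu → adjacent (proposal-crosses M pu))
                , (λ v u av → accept⇒propose M av , acceptor-silent av)
    where
    acceptor-silent : ∀ {u v} → accept (round M) v ≡ just u → propose (round M) v ≡ nothing
    acceptor-silent {v = v} av with propose (round M) v in pv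
    ... | nothing = refl
    ... | just w  = case trans (sym (informed-end (proposal-crosses M pv)))
                               (uninformed-end (proposal-crosses M (accept⇒propose M av))) of λ ()

  FreeNeighbour : Matching → Fin n → Fin n → Set
  FreeNeighbour M u v = X v ≡ false × Adj G u v × accept (round M) v ≡ nothing

  free-neighbour? : ∀ M u v → Dec (FreeNeighbour M u v)
  free-neighbour? M u v =
    X v Bool.≟ false ×-dec adj G u v Bool.≟ true ×-dec unmatched? (accept (round M) v)
    where
    unmatched? : (m : Maybe (Fin n)) → Dec (m ≡ nothing)
    unmatched? nothing  = yes refl
    unmatched? (just _) = no λ ()

  saturate : ∀ M u → Σ Matching λ M' → M ⊑ M' × Saturated M' u
  saturate M u with X u in Xu | propose (round M) u in pu
  ... | false | _      = M , ⊑-refl , λ ()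
  ... | true  | just v = M , ⊑-refl , λ _ → inj₁ (v , pu)
  ... | true  | nothing with Fin.any? (free-neighbour? M u)
  ...   | yes (v , Xv , uv , av) =
          let (M' , M⊑M' , pu') = add-edge M pu av Xu Xv uv in M' , M⊑M' , λ _ → inj₁ (v , pu')
  ...   | no no-free = M , ⊑-refl , λ _ → inj₂ matched
    where
    matched : ∀ v → X v ≡ false → Adj G u v → ∃ λ w → accept (round M) v ≡ just w
    matched v Xv uv with accept (round M) v in av
    ... | just w  = w , refl
    ... | nothing = contradiction (v , Xv , uv , av) no-free

  saturate-all : ∀ M (us : List (Fin n)) → Σ Matching λ M' → M ⊑ M' × (∀ {u} → u ∈ us → Saturated M' u)
  saturate-all M []       = M , ⊑-refl , λ ()
  saturate-all M (u ∷ us) =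
    let (M₁ , M⊑M₁ , sat-u)  = saturate M u
        (M₂ , M₁⊑M₂ , sat-us) = saturate-all M₁ us
    in M₂ , ⊑-trans M⊑M₁ M₁⊑M₂
          , λ { (here refl) → Saturated-mono u M₁⊑M₂ sat-u ; (there u∈us) → sat-us u∈us }

  maximal-matching : Σ Matching λ M → ∀ u → Saturated M u
  maximal-matching = let (M , _ , sat) = saturate-all ∅ (allFin n) in M , λ u → sat (∈-allFin u)

-- Vertex expansion

module Expansion {n : ℕ} (G : Graph n) where

  ∂ : (Fin n → Bool) → Fin n → Bool
  ∂ h v = not (h v) ∧ anyFin (λ u → h u ∧ adj G u v)

  ∣boundary∣≡count∂ : ∀ h → ∣ boundary G (tabulate h) ∣ ≡ count (∂ h)
  ∣boundary∣≡count∂ h = trans (∣tabulate∣≡count (∂ (lookup (tabulate h)))) (count-cong λ v →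
    cong₂ (λ hv nbr → not hv ∧ nbr) (lookup∘tabulate h v)
      (anyFin-cong λ u → cong (_∧ adj G u v) (lookup∘tabulate h u)))

  record ExpansionAtLeast (p q : ℕ) : Set where
    field
      expands : ∀ (S : Subset n) → 0 < ∣ S ∣ → 2 * ∣ S ∣ ≤ n → p * ∣ S ∣ ≤ ∣ boundary G S ∣ * q
  open ExpansionAtLeast

  expands-all : ∀ {p q} → ExpansionAtLeast p q → ∀ S → 2 * ∣ S ∣ ≤ n → p * ∣ S ∣ ≤ ∣ boundary G S ∣ * q
  expands-all {p} {q} p/q≤α S 2|S|≤n with 0 <? ∣ S ∣
  ... | yes 0<|S| = expands p/q≤α S 0<|S| 2|S|≤n
  ... | no  0≮|S| = begin
    p * ∣ S ∣                ≡⟨ cong (p *_) (n≤0⇒n≡0 (≮⇒≥ 0≮|S|)) ⟩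
    p * 0                    ≡⟨ *-zeroʳ p ⟩
    0                        ≤⟨ z≤n ⟩
    ∣ boundary G S ∣ * q     ∎
    where open ≤-Reasoning

  expansion : ∀ {p q} → ExpansionAtLeast p q → ∀ h → 2 * count h ≤ n → p * count h ≤ count (∂ h) * q
  expansion {p} {q} p/q≤α h 2|h|≤n =
    subst₂ (λ c c∂ → p * c ≤ c∂ * q) (∣tabulate∣≡count h) (∣boundary∣≡count∂ h)
      (expands-all p/q≤α (tabulate h) (subst (λ c → 2 * c ≤ n) (sym (∣tabulate∣≡count h)) 2|h|≤n))

  ∂⊆not : ∀ h v → ∂ h v ≡ true → not (h v) ≡ true
  ∂⊆not h v ∂hv with h v
  ... | false = refl

  count∂+count≤n : ∀ h → count (∂ h) + count h ≤ n
  count∂+count≤n h = begin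
    count (∂ h) + count h       ≤⟨ +-monoˡ-≤ (count h) (count-mono (∂⊆not h)) ⟩
    count (not ∘ h) + count h   ≡⟨ +-comm (count (not ∘ h)) (count h) ⟩
    count h + count (not ∘ h)   ≡⟨ count+count-not≡n h ⟩
    n                           ∎
    where open ≤-Reasoning

  -- Test the expansion on the first ⌊n/2⌋ vertices, whose boundary has at most ⌈n/2⌉ ≤ 2⌊n/2⌋ elements.
  ExpansionAtLeast⇒p≤2q : ∀ {p q} → ExpansionAtLeast p q → 2 ≤ n → p ≤ 2 * q
  ExpansionAtLeast⇒p≤2q {p} {q} p/q≤α 2≤n = *-cancelʳ-≤ p (2 * q) k {{>-nonZero 0<k}} (begin
    p * k                  ≤⟨ subst (λ c → p * c ≤ count (∂ half) * q) |half|≡k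
                                (expansion p/q≤α half (subst (λ c → 2 * c ≤ n) (sym |half|≡k) (2*⌊n/2⌋≤n n))) ⟩
    count (∂ half) * q     ≤⟨ *-monoˡ-≤ q |∂half|≤1+k ⟩
    (1 + k) * q            ≤⟨ *-monoˡ-≤ q (+-monoˡ-≤ k 0<k) ⟩
    (k + k) * q            ≡⟨ rearrange k q ⟩
    2 * q * k              ∎)
    where
    open ≤-Reasoning
    k = ⌊ n /2⌋
    0<k : 0 < k
    0<k = 0<⌊n/2⌋ 2≤n
    rearrange : ∀ k q → (k + k) * q ≡ 2 * q * k
    rearrange = solve-∀
    half : Fin n → Bool
    half i = toℕ i <ᵇ k
    |half|≡k : count half ≡ k
    |half|≡k = count-<ᵇ k (⌊n/2⌋≤n n)
    |∂half|≤1+k : count (∂ half) ≤ 1 + k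
    |∂half|≤1+k = ≤-trans (+-cancelʳ-≤ k _ _ (begin
      count (∂ half) + k       ≡⟨ cong (count (∂ half) +_) |half|≡k ⟨
      count (∂ half) + count half ≤⟨ count∂+count≤n half ⟩
      n                        ≡⟨ ⌊n/2⌋+⌈n/2⌉≡n n ⟨
      k + ⌈ n /2⌉              ≡⟨ +-comm k ⌈ n /2⌉ ⟩
      ⌈ n /2⌉ + k              ∎)) (⌈n/2⌉≤1+⌊n/2⌋ n)

  reach⇒∂ : ∀ h {u w} → Reach G u w → h u ≡ true → h w ≡ false → ∃ λ x → ∂ h x ≡ true
  reach⇒∂ h here hu hw = case trans (sym hu) hw of λ ()
  reach⇒∂ h {w = w} (step {v} u⇝v vw) hu hw with h v in hv
  ... | false = reach⇒∂ h u⇝v hu hv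
  ... | true  = w , subst (λ b → not b ∧ anyFin (λ x → h x ∧ adj G x w) ≡ true) (sym hw)
                      (∃⇒anyFin (λ x → h x ∧ adj G x w) (cong₂ _∧_ hv vw))

  connected⇒0<count∂ : Connected G → ∀ h → 0 < count h → 0 < count (not ∘ h) → 0 < count (∂ h)
  connected⇒0<count∂ connected h 0<|h| 0<|¬h| =
    let (u , hu) = count-pos⇒∃ h 0<|h|
        (w , ¬hw) = count-pos⇒∃ (not ∘ h) 0<|¬h|
        (x , ∂hx) = reach⇒∂ h (connected u w) hu (Bool.not-injective ¬hw)
    in count-pos (∂ h) ∂hx

  ≤n/2⇒count≤count-not : ∀ h → 2 * count h ≤ n → count h ≤ count (not ∘ h)
  ≤n/2⇒count≤count-not h 2|h|≤n = +-cancelˡ-≤ (count h) _ _ (begin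
    count h + count h           ≡⟨ cong (count h +_) (+-identityʳ (count h)) ⟨
    2 * count h                 ≤⟨ 2|h|≤n ⟩
    n                           ≡⟨ count+count-not≡n h ⟨
    count h + count (not ∘ h)   ∎)
    where open ≤-Reasoning

  connected⇒0<p : ∀ {p q} → Connected G → 0 < q →
    (∃ λ (S : Subset n) → 0 < ∣ S ∣ × 2 * ∣ S ∣ ≤ n × ∣ boundary G S ∣ * q ≡ p * ∣ S ∣) → 0 < p
  connected⇒0<p {suc p} _         _   _                              = s≤s z≤n
  connected⇒0<p {zero}  connected 0<q (S , 0<|S| , 2|S|≤n , |∂S|q≡0) =
    contradiction |∂S|q≡0 (>⇒≢ (*-mono-≤ 0<|∂S| 0<q))
    where
    h = lookup S
    0<|h| : 0 < count h
    0<|h| = subst (0 <_) (∣S∣≡count S) 0<|S|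
    0<|∂S| : 0 < ∣ boundary G S ∣
    0<|∂S| = subst (0 <_) (sym (∣tabulate∣≡count (∂ h)))
      (connected⇒0<count∂ connected h 0<|h|
        (≤-trans 0<|h| (≤n/2⇒count≤count-not h (subst (λ c → 2 * c ≤ n) (∣S∣≡count S) 2|S|≤n))))

  -- Z ∖ MZ has its whole boundary inside MZ ∪ MZ̄, so α|Z ∖ MZ| ≤ 2m, and α ≤ 2 accounts for MZ.
  maximal-matching-bound : ∀ {p q} → ExpansionAtLeast p q → p ≤ 2 * q →
    ∀ (Z MZ MZ̄ : Fin n → Bool) {m} →
    (∀ x → MZ x ≡ true → Z x ≡ true) →
    (∀ {u v} → Z u ≡ true → MZ u ≡ false → Adj G u v → Z v ≡ false → MZ̄ v ≡ true) →
    count MZ ≡ m → count MZ̄ ≡ m → 2 * count Z ≤ n → p * count Z ≤ 4 * (q * m)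
  maximal-matching-bound {p} {q} p/q≤α p≤2q Z MZ MZ̄ {m} MZ⊆Z unmatched-edge |MZ| |MZ̄| 2|Z|≤n = begin
    p * count Z                     ≡⟨ cong (p *_) (count-∖+count Z MZ MZ⊆Z) ⟨
    p * (count S + count MZ)        ≡⟨ cong (λ c → p * (count S + c)) |MZ| ⟩
    p * (count S + m)               ≡⟨ *-distribˡ-+ p (count S) m ⟩
    p * count S + p * m             ≤⟨ +-mono-≤ (expansion p/q≤α S 2|S|≤n) (*-monoˡ-≤ m p≤2q) ⟩
    count (∂ S) * q + 2 * q * m     ≤⟨ +-monoˡ-≤ (2 * q * m) (*-monoˡ-≤ q |∂S|≤2m) ⟩
    (m + m) * q + 2 * q * m         ≡⟨ rearrange m q ⟩
    4 * (q * m)                     ∎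
    where
    open ≤-Reasoning
    S : Fin n → Bool
    S x = Z x ∧ not (MZ x)
    2|S|≤n : 2 * count S ≤ n
    2|S|≤n = ≤-trans (*-monoʳ-≤ 2 (count-mono λ x → ∧-conicalˡ (Z x) _)) 2|Z|≤n
    ∂S⊆MZ∪MZ̄ : ∀ x → ∂ S x ≡ true → (MZ x ∨ MZ̄ x) ≡ true
    ∂S⊆MZ∪MZ̄ x ∂Sx with Z x in Zx | MZ x
    ... | _     | true  = refl
    ... | false | false =
      let (u , Su∧ux) = anyFin⇒∃ (λ u → S u ∧ adj G u x) (∧-conicalʳ _ _ ∂Sx)
          Su = ∧-conicalˡ (S u) _ Su∧ux
      in unmatched-edge (∧-conicalˡ (Z u) _ Su) (Bool.not-injective (∧-conicalʳ (Z u) _ Su))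
                        (∧-conicalʳ (S u) _ Su∧ux) Zx
    |∂S|≤2m : count (∂ S) ≤ m + m
    |∂S|≤2m = begin
      count (∂ S)                      ≤⟨ count-mono ∂S⊆MZ∪MZ̄ ⟩
      count (λ x → MZ x ∨ MZ̄ x)        ≤⟨ count-∨≤ MZ MZ̄ ⟩
      count MZ + count MZ̄              ≡⟨ cong₂ _+_ |MZ| |MZ̄| ⟩
      m + m                            ∎
    rearrange : ∀ m q → (m + m) * q + 2 * q * m ≡ 4 * (q * m)
    rearrange = solve-∀

-- Growth of the informed set

module MatchingRound {n : ℕ} (G : Graph n) (X : Fin n → Bool) where
  open GreedyMatching G X
  open Expansion G

  M : Matching
  M = proj₁ maximal-matching

  open Matching M public

  proposers acceptors : Fin n → Bool
  proposers = is-just ∘ propose round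
  acceptors = is-just ∘ accept round

  #matched : ℕ
  #matched = count proposers

  next : Fin n → Bool
  next v = X v ∨ acceptors v

  proposer-informed : ∀ x → proposers x ≡ true → X x ≡ true
  proposer-informed x _ with propose round x in px
  ... | just _ = informed-end (proposal-crosses px)

  acceptor-uninformed : ∀ x → acceptors x ≡ true → X x ≡ false
  acceptor-uninformed x _ with accept round x in ax
  ... | just _ = uninformed-end (proposal-crosses (accept⇒propose ax))

  count-next : count next ≡ count X + #matched
  count-next = begin
    count next                                   ≡⟨ +-identityʳ _ ⟨
    count next + 0                               ≡⟨ cong (count next +_) (all-false⇒count≡0 _ disjoint) ⟨
    count next + count (λ x → X x ∧ acceptors x) ≡⟨ count-∨+count-∧ X acceptors ⟩
    count X + count acceptors                    ≡⟨ cong (count X +_) #proposers≡#acceptors ⟨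
    count X + #matched                           ∎
    where
    open ≡-Reasoning
    disjoint : ∀ x → X x ∧ acceptors x ≡ false
    disjoint x with acceptors x in ax
    ... | false = Bool.∧-zeroʳ (X x)
    ... | true  = cong (_∧ true) (acceptor-uninformed x ax)

  acceptor-linked : ∀ v → acceptors v ≡ true → ∃ λ u → X u ≡ true × Linked round u v
  acceptor-linked v _ with accept round v in av
  ... | just u = u , proposer-informed u (cong is-just pu) , inj₁ (pu , refl)
    where pu = accept⇒propose av

  round-valid : ValidRound G round
  round-valid = matching-valid M

  saturated : ∀ u → Saturated M u
  saturated = proj₂ maximal-matching

  module _ {p q} (p/q≤α : ExpansionAtLeast p q) (p≤2q : p ≤ 2 * q) where

    informed-bound : 2 * count X ≤ n → p * count X ≤ 4 * (q * #matched)
    informed-bound = maximal-matching-bound p/q≤α p≤2q X proposers acceptors proposer-informed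
      unmatched-edge refl (sym #proposers≡#acceptors)
      where
      unmatched-edge : ∀ {u v} → X u ≡ true → proposers u ≡ false → Adj G u v → X v ≡ false →
                       acceptors v ≡ true
      unmatched-edge {u} {v} Xu ¬pu uv Xv with saturated u Xu
      ... | inj₁ (_ , pu) = case trans (sym (cong is-just pu)) ¬pu of λ ()
      ... | inj₂ matched  = cong is-just (proj₂ (matched v Xv uv))

    uninformed-bound : 2 * count (not ∘ X) ≤ n → p * count (not ∘ X) ≤ 4 * (q * #matched)
    uninformed-bound = maximal-matching-bound p/q≤α p≤2q (not ∘ X) acceptors proposers
      (λ x ax → cong not (acceptor-uninformed x ax)) unmatched-edge (sym #proposers≡#acceptors) refl
      where
      unmatched-edge : ∀ {u v} → not (X u) ≡ true → acceptors u ≡ false → Adj G u v → not (X v) ≡ false →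
                       proposers v ≡ true
      unmatched-edge {u} {v} ¬Xu ¬au uv ¬Xv with saturated v (Bool.not-injective ¬Xv)
      ... | inj₁ (_ , pv) = cong is-just pv
      ... | inj₂ matched  = case trans (sym (cong is-just (proj₂ (matched u Xu vu)))) ¬au of λ ()
        where
        Xu = Bool.not-injective ¬Xu
        vu = trans (Graph.sym G v u) uv

-- a t and b t are the numbers of informed and uninformed nodes after t rounds, m t the size of the
-- matching of round t.
module Phases
  (n p q : ℕ) (0<p : 0 < p) (0<q : 0 < q)
  (a b m : ℕ → ℕ)
  (a+b≡n : ∀ t → a t + b t ≡ n)
  (a-step : ∀ t → a (suc t) ≡ a t + m t)
  (a-expands : ∀ t → 2 * a t ≤ n → p * a t ≤ 4 * (q * m t))
  (b-expands : ∀ t → 2 * b t ≤ n → p * b t ≤ 4 * (q * m t))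
  where

  instance
    p≢0 : NonZero p
    p≢0 = >-nonZero 0<p

  Q : ℕ
  Q = 4 * q

  -- A block of R ≥ 8q/p rounds, each informing at least p c/4q new nodes, informs at least 2c of them.
  R : ℕ
  R = suc (8 * q / p)

  8q≤R*p : 8 * q ≤ R * p
  8q≤R*p = begin
    8 * q                          ≡⟨ m≡m%n+[m/n]*n (8 * q) p ⟩
    8 * q % p + 8 * q / p * p      ≤⟨ +-monoˡ-≤ _ (<⇒≤ (m%n<n (8 * q) p)) ⟩
    p + 8 * q / p * p              ∎
    where open ≤-Reasoning

  R*p≤p+8q : R * p ≤ p + 8 * q
  R*p≤p+8q = +-monoʳ-≤ p (m/n*n≤m (8 * q) p)

  a-mono : ∀ {t t'} → t ≤ t' → a t ≤ a t'
  a-mono {t} {t'} t≤t' = subst (λ t' → a t ≤ a t') (m∸n+n≡m t≤t') (go (t' ∸ t))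
    where
    go : ∀ k → a t ≤ a (k + t)
    go zero    = ≤-refl
    go (suc k) = ≤-trans (go k) (subst (a (k + t) ≤_) (sym (a-step (k + t))) (m≤m+n _ _))

  b-antitone : ∀ {t t'} → t ≤ t' → b t' ≤ b t
  b-antitone {t} {t'} t≤t' = +-cancelˡ-≤ (a t) _ _ (begin
    a t + b t'     ≤⟨ +-monoˡ-≤ (b t') (a-mono t≤t') ⟩
    a t' + b t'    ≡⟨ trans (a+b≡n t') (sym (a+b≡n t)) ⟩
    a t + b t      ∎)
    where open ≤-Reasoning

  Q-growth : ∀ {t c} → c ≤ 4 * (q * m t) → Q * a t + c ≤ Q * a (suc t)
  Q-growth {t} {c} c≤4qm = begin
    Q * a t + c              ≤⟨ +-monoʳ-≤ (Q * a t) c≤4qm ⟩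
    Q * a t + 4 * (q * m t)  ≡⟨ cong (Q * a t +_) (*-assoc 4 q (m t)) ⟨
    Q * a t + Q * m t        ≡⟨ *-distribˡ-+ Q (a t) (m t) ⟨
    Q * (a t + m t)          ≡⟨ cong (Q *_) (a-step t) ⟨
    Q * a (suc t)            ∎
    where open ≤-Reasoning

  block-growth : ∀ t c → (∀ i → i < R → p * c ≤ 4 * (q * m (i + t))) → a t + 2 * c ≤ a (R + t)
  block-growth t c progress = *-cancelˡ-≤ Q {{>-nonZero (≤-trans 0<q (m≤n*m q 4))}} (begin
    Q * (a t + 2 * c)         ≡⟨ rearrange q (a t) c ⟩
    Q * a t + 8 * q * c       ≤⟨ +-monoʳ-≤ (Q * a t) (*-monoˡ-≤ c 8q≤R*p) ⟩
    Q * a t + R * p * c       ≡⟨ cong (Q * a t +_) (*-assoc R p c) ⟩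
    Q * a t + R * (p * c)     ≤⟨ accumulate (λ t → Q * a t) (p * c) R t (λ i i<R → Q-growth (progress i i<R)) ⟩
    Q * a (R + t)             ∎)
    where
    open ≤-Reasoning
    rearrange : ∀ q x c → 4 * q * (x + 2 * c) ≡ 4 * q * x + 8 * q * c
    rearrange = solve-∀

  tripling : ∀ t → 2 * a (R + t) < n → 3 * a t ≤ a (R + t)
  tripling t 2a<n = subst (_≤ a (R + t)) (x+2x≡3x (a t)) (block-growth t (a t) λ i i<R →
    ≤-trans (*-monoʳ-≤ p (a-mono (m≤n+m t i)))
            (a-expands (i + t) (≤-trans (*-monoʳ-≤ 2 (a-mono (+-monoˡ-≤ t (<⇒≤ i<R)))) (<⇒≤ 2a<n))))
    where
    x+2x≡3x : ∀ x → x + 2 * x ≡ 3 * x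
    x+2x≡3x = solve-∀

  thirding : ∀ t → n ≤ 2 * a t → 3 * b (R + t) ≤ b t
  thirding t n≤2a = +-cancelˡ-≤ (a t) _ _ (begin
    a t + 3 * b'              ≡⟨ rearrange (a t) b' ⟩
    (a t + 2 * b') + b'       ≤⟨ +-monoˡ-≤ b' (block-growth t b' progress) ⟩
    a (R + t) + b'            ≡⟨ trans (a+b≡n (R + t)) (sym (a+b≡n t)) ⟩
    a t + b t                 ∎)
    where
    open ≤-Reasoning
    b' = b (R + t)
    progress : ∀ i → i < R → p * b' ≤ 4 * (q * m (i + t))
    progress i i<R = ≤-trans (*-monoʳ-≤ p (b-antitone (+-monoˡ-≤ t (<⇒≤ i<R))))
      (b-expands (i + t) (≤-trans (*-monoʳ-≤ 2 (b-antitone (m≤n+m t i)))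
                                  (complement-≤half {a t} (a+b≡n t) n≤2a)))
    rearrange : ∀ x y → x + 3 * y ≡ (x + 2 * y) + y
    rearrange = solve-∀

  first-phase : 1 ≤ a 0 → ∀ j → n ≤ 2 * a (j * R) ⊎ 2 ^ j ≤ a (j * R)
  first-phase 1≤a₀ zero = inj₂ 1≤a₀
  first-phase 1≤a₀ (suc j) with first-phase 1≤a₀ j
  ... | inj₁ n≤2a = inj₁ (≤-trans n≤2a (*-monoʳ-≤ 2 (a-mono (m≤n+m (j * R) R))))
  ... | inj₂ 2^j≤a with n ≤? 2 * a (R + j * R)
  ...   | yes n≤2a = inj₁ n≤2a
  ...   | no  n≰2a = inj₂ (begin
    2 * 2 ^ j              ≤⟨ *-monoʳ-≤ 2 2^j≤a ⟩
    2 * a (j * R)          ≤⟨ *-monoˡ-≤ (a (j * R)) (n≤1+n 2) ⟩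
    3 * a (j * R)          ≤⟨ tripling (j * R) (≰⇒> n≰2a) ⟩
    a (R + j * R)          ∎)
    where open ≤-Reasoning

  half-informed : 1 ≤ a 0 → ∀ K → n ≤ 2 ^ K → n ≤ 2 * a (K * R)
  half-informed 1≤a₀ K n≤2^K with first-phase 1≤a₀ K
  ... | inj₁ n≤2a   = n≤2a
  ... | inj₂ 2^K≤a  = ≤-trans n≤2^K (≤-trans 2^K≤a (m≤n*m (a (K * R)) 2))

  second-phase : ∀ {t₀} → n ≤ 2 * a t₀ → ∀ j → 3 ^ j * b (j * R + t₀) ≤ n
  second-phase {t₀} n≤2a zero = begin
    1 * b t₀        ≡⟨ *-identityˡ (b t₀) ⟩
    b t₀            ≤⟨ m≤n+m (b t₀) (a t₀) ⟩
    a t₀ + b t₀     ≡⟨ a+b≡n t₀ ⟩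
    n               ∎
    where open ≤-Reasoning
  second-phase {t₀} n≤2a (suc j) = begin
    3 ^ suc j * b ((R + j * R) + t₀)    ≡⟨ cong (λ t → 3 ^ suc j * b t) (+-assoc R (j * R) t₀) ⟩
    3 * 3 ^ j * b (R + t)               ≡⟨ *-assoc 3 (3 ^ j) (b (R + t)) ⟩
    3 * (3 ^ j * b (R + t))             ≡⟨ x*[y*z]≡y*[x*z] 3 (3 ^ j) (b (R + t)) ⟩
    3 ^ j * (3 * b (R + t))             ≤⟨ *-monoʳ-≤ (3 ^ j) (thirding t n≤2a[t]) ⟩
    3 ^ j * b t                         ≤⟨ second-phase n≤2a j ⟩
    n                                   ∎
    where
    open ≤-Reasoning
    t = j * R + t₀
    n≤2a[t] : n ≤ 2 * a t
    n≤2a[t] = ≤-trans n≤2a (*-monoʳ-≤ 2 (a-mono (m≤n+m t₀ (j * R))))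
    x*[y*z]≡y*[x*z] : ∀ x y z → x * (y * z) ≡ y * (x * z)
    x*[y*z]≡y*[x*z] = solve-∀

  rounds : ℕ → ℕ
  rounds K = K * R + K * R

  b-vanishes : 1 ≤ a 0 → ∀ K → 1 ≤ K → n ≤ 2 ^ K → b (rounds K) ≡ 0
  b-vanishes 1≤a₀ K 1≤K n≤2^K with b (rounds K) | second-phase (half-informed 1≤a₀ K n≤2^K) K
  ... | zero  | _          = refl
  ... | suc c | 3^K*b≤n    = contradiction (begin-strict
    2 ^ K              <⟨ ^-monoˡ-< K {{>-nonZero 1≤K}} (n<1+n 2) ⟩
    3 ^ K              ≤⟨ m≤m*n (3 ^ K) (suc c) ⟩
    3 ^ K * suc c      ≤⟨ 3^K*b≤n ⟩
    n                  ≤⟨ n≤2^K ⟩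
    2 ^ K              ∎) (<-irrefl refl)
    where open ≤-Reasoning

  time-bound : p ≤ 2 * q → ∀ K → rounds K * p ≤ 20 * K * q
  time-bound p≤2q K = begin
    (K * R + K * R) * p      ≡⟨ rearrange K R p ⟩
    2 * K * (R * p)          ≤⟨ *-monoʳ-≤ (2 * K) (≤-trans R*p≤p+8q (+-monoˡ-≤ (8 * q) p≤2q)) ⟩
    2 * K * (2 * q + 8 * q)  ≡⟨ rearrange′ K q ⟩
    20 * K * q               ∎
    where
    open ≤-Reasoning
    rearrange : ∀ K R p → (K * R + K * R) * p ≡ 2 * K * (R * p)
    rearrange = solve-∀
    rearrange′ : ∀ K q → 2 * K * (2 * q + 8 * q) ≡ 20 * K * q
    rearrange′ = solve-∀

module GreedySpreading {n : ℕ} (G : Graph n) (s : Fin n) where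
  open MatchingRound G using (next; round; acceptor-linked)
  open Expansion G using (ExpansionAtLeast)

  informed : ℕ → Fin n → Bool
  informed zero    v = does (v ≟ s)
  informed (suc t)   = next (informed t)

  schedule : Schedule n
  schedule t = round (informed t)

  schedule-valid : ValidSchedule G schedule
  schedule-valid t = MatchingRound.round-valid G (informed t)

  informed-sound : ∀ t v → informed t v ≡ true → Informed schedule s t v
  informed-sound zero v _ with v ≟ s
  ... | yes refl = source
  informed-sound (suc t) v nextv with informed t v in Xv
  ... | true  = keep (informed-sound t v Xv)
  ... | false = let (u , Xu , u~v) = acceptor-linked (informed t) v nextv
                in recv (informed-sound t u Xu) u~v

  module Analysis {p q} (0<p : 0 < p) (0<q : 0 < q) (p/q≤α : ExpansionAtLeast p q) (p≤2q : p ≤ 2 * q)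
    where
    open Phases n p q 0<p 0<q
      (λ t → count (informed t)) (λ t → count (not ∘ informed t))
      (λ t → MatchingRound.#matched G (informed t))
      (λ t → count+count-not≡n (informed t))
      (λ t → MatchingRound.count-next G (informed t))
      (λ t → MatchingRound.informed-bound G (informed t) p/q≤α p≤2q)
      (λ t → MatchingRound.uninformed-bound G (informed t) p/q≤α p≤2q)
      public using (rounds; time-bound; b-vanishes)

    all-informed : ∀ K → 1 ≤ K → n ≤ 2 ^ K → ∀ v → Informed schedule s (rounds K) v
    all-informed K 1≤K n≤2^K v = informed-sound (rounds K) v (Bool.not-injective
      (count≡0⇒false (not ∘ informed (rounds K)) (b-vanishes source-informed K 1≤K n≤2^K) v))
      where source-informed = count-pos (informed 0) {s} (dec-true (s ≟ s) refl)

theorem1 : ∃ λ (C : ℕ) → ∀ (n : ℕ) → 2 ≤ n → (G : Graph n) → Connected G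
             → (p q : ℕ) → IsVertexExpansion G p q → (s : Fin n)
             → ∃ λ (σ : Schedule n) → ∃ λ (T : ℕ)
                 → ValidSchedule G σ
                 × T * p ≤ C * ⌈log₂ n ⌉ * q
                 × (∀ (v : Fin n) → Informed σ s T v)
theorem1 = 20 , λ n 2≤n G connected p q (0<q , witness , lower) s →
  let open Expansion G
      open GreedySpreading G s
      p/q≤α : ExpansionAtLeast p q
      p/q≤α = record { expands = lower }
      p≤2q = ExpansionAtLeast⇒p≤2q p/q≤α 2≤n
      open Analysis (connected⇒0<p connected 0<q witness) 0<q p/q≤α p≤2q
      K = ⌈log₂ n ⌉
  in schedule , rounds K , schedule-valid , time-bound p≤2q K
     , all-informed K (1≤⌈log₂n⌉ 2≤n) (n≤2^⌈log₂n⌉ n)
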